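{- Let $m \geq 2$, $q$ and $r$ be positive integers with $q + 1 = rm$, and let $S := \langle m, q\rangle$ be the numerical semigroup generated by $m$ and $q$. Put $s := q\left(\left\lceil \frac{m}{2}\right\rceil - 1\right)$. Then $\sigma$ attains its maximum over $S \cap [0,c(S)]$ at $s$, and $$\sigma(s) = \begin{cases} \frac{1}{8}(m-2)(q-1) & \text{if } m \text{ is even},\\[2pt] \frac{1}{8}(m-1)(q-r-1) & \text{if } m \text{ is odd}.\end{cases}$$
   Context: A numerical semigroup is a subset $S \subseteq \mathbb{N} = \{0,1,2,\ldots\}$ closed under addition, containing $0$, with finite complement. Its Frobenius number is $F(S) := \max(\mathbb{N}\setminus S)$ and its conductor is $c(S) := F(S)+1$. For $s \in S \cap [0,c(S)]$ define $\sigma(s) := \frac{s}{2} - |S \cap [0,s]| + 1$. -}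

module Defs where

open import Data.Bool using (Bool; true; false)
open import Data.Nat as ℕ using (ℕ; zero; suc; _+_; _*_; _≡ᵇ_; _<_; _≤_)
open import Data.List using (List; upTo; filter; length)
open import Data.Bool.ListAction using (any)
open import Data.Integer as ℤ using (ℤ; +_)
open import Data.Rational as ℚ using (ℚ; _/_; _-_)
open import Relation.Binary.PropositionalEquality using (_≡_)
open import Relation.Nullary using (¬_)
open import Data.Bool using (T)
open import Relation.Nullary.Decidable using (Dec; yes; no)
open import Data.Bool.Properties using (T?)

-- Membership in the numerical semigroup ⟨m, q⟩ = { a*m + b*q | a b ∈ ℕ },
-- decided by bounded search (a, b ≤ n suffice whenever m, q ≥ 1).
memb : ℕ → ℕ → ℕ → Bool
memb m q n = any (λ a → any (λ b → (a * m + b * q) ≡ᵇ n) (upTo (suc n))) (upTo (suc n))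

InS : ℕ → ℕ → ℕ → Set
InS m q n = T (memb m q n)

IsFrobenius : ℕ → ℕ → ℕ → Set
IsFrobenius m q F = ¬ InS m q F × (∀ n → F < n → InS m q n)
  where open import Data.Product using (_×_)

countS : ℕ → ℕ → ℕ → ℕ
countS m q s = length (filter (λ n → T? (memb m q n)) (upTo (suc s)))

σ : ℕ → ℕ → ℕ → ℚ
σ m q s = ((+ s) / 2 - (+ countS m q s) / 1) ℚ.+ (+ 1) / 1

-- Write n ≥ 1 as x*m + j with 1 ≤ j ≤ m.  Since q ≡ −1 (mod m), x*m + j ∈ S iff (m − j)*r ≤ x + 1,
-- so the block x*m + 1, …, x*m + m consists of ℓ x = m − 1 − ⌊(x + 1)/r⌋ gaps followed by elements
-- of S.  With excess t = 2|S ∩ [0,t]| − t one has σ t = (2 − excess t)/2, so σ is largest where the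
-- excess is smallest.  Along block x the excess falls through the gaps and rises through the elements,
-- so over S ∩ block x it is least at the first element; from one block to the next these minima change
-- by m − ℓ x − ℓ (x + 1), which is first ≤ 0 and then ≥ 0 since ℓ is non-increasing.  The turn is
-- at block h*r − 1 (h = ⌈m/2⌉ − 1), whose first element is s = h*q.  Summing over runs of r blocks,
-- on which ℓ is essentially constant, gives excess (y*q) = 2 − y(r(m − 1 − y) − 1), and the two
-- closed forms follow.

module Submission where

open import Defs
open import Data.Bool using (true; false; T; if_then_else_)
open import Data.Bool.Properties using (T?)
import Data.Bool.ListAction as Bool
open import Data.Nat as ℕ
  using (ℕ; zero; suc; _+_; _*_; _∸_; _≤_; _<_; _≡ᵇ_; z≤n; s≤s; s≤s⁻¹; NonZero)
  using (_≤′_; ≤′-refl; ≤′-step; ⌈_/2⌉; ⌊_/2⌋)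
open import Data.Nat.Properties
open import Data.Nat.DivMod using (_%_; /-monoˡ-≤; m*n/n≡m; m/n*n≤m; m%n<n; m≡m%n+[m/n]*n)
open import Data.Nat.Divisibility using (_∣_; divides; ∣1⇒≡1; ∣m+n∣m⇒∣n)
open import Data.Nat.Tactic.RingSolver using (solve)
open import Data.Integer as ℤ using (ℤ; +_; 1ℤ) renaming (_-_ to _-ℤ_; _*_ to _*ℤ_)
import Data.Integer.Properties as ℤ
open import Data.Integer.Tactic.RingSolver using (solve-∀)
open import Data.Rational as ℚ using (_/_; toℚᵘ) renaming (_≤_ to _≤ℚ_)
import Data.Rational.Properties as ℚ
open import Data.Rational.Unnormalised as ℚᵘ using (mkℚᵘ; *≡*; *≤*)
import Data.Rational.Unnormalised.Properties as ℚᵘ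
open import Data.List using ([]; _∷_; _++_; upTo; filter; length; _∷ʳ_)
open import Data.List.Properties using (upTo-∷ʳ; filter-++; length-++)
import Data.List.Relation.Unary.Any as Any
open import Data.List.Relation.Unary.Any.Properties using (any⁺; any⁻)
open import Data.List.Membership.Propositional.Properties using (∈-upTo⁺)
open import Data.Product using (∃₂; _,_; _×_)
open import Data.Sum using (_⊎_; inj₁; inj₂)
open import Function using (_∘_)
open import Relation.Binary.PropositionalEquality
open import Relation.Nullary using (¬_; Dec; contradiction)

/-cross : ∀ (p q : ℤ) a b → p ℤ.* + suc b ≡ q ℤ.* + suc a → p / suc a ≡ q / suc b
/-cross p q a b cross = ℚ.fromℚᵘ-cong {mkℚᵘ p a} {mkℚᵘ q b} (*≡* cross)

m*o≤n⇒m≤n/o : ∀ {m n o} .{{_ : NonZero o}} → m * o ≤ n → m ≤ n ℕ./ o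
m*o≤n⇒m≤n/o {m} {n} {o} m*o≤n = subst (_≤ n ℕ./ o) (m*n/n≡m m o) (/-monoˡ-≤ o m*o≤n)

m≤n/o⇒m*o≤n : ∀ {m n o} .{{_ : NonZero o}} → m ≤ n ℕ./ o → m * o ≤ n
m≤n/o⇒m*o≤n {m} {n} {o} m≤n/o = ≤-trans (*-monoˡ-≤ o m≤n/o) (m/n*n≤m n o)

+-offset-≤ : ∀ {i j : ℤ} {m n : ℕ} → i ℤ.+ + m ≡ j ℤ.+ + n → n ≤ m → i ℤ.≤ j
+-offset-≤ {i} {j} {m} {n} i+m≡j+n n≤m = begin
  i                      ≡⟨ regroup i (+ m) ⟩
  i ℤ.+ + m ℤ.- + m      ≡⟨ cong (ℤ._- + m) i+m≡j+n ⟩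
  j ℤ.+ + n ℤ.- + m      ≤⟨ ℤ.+-monoʳ-≤ (j ℤ.+ + n) (ℤ.neg-mono-≤ (ℤ.+≤+ n≤m)) ⟩
  j ℤ.+ + n ℤ.- + n      ≡⟨ regroup j (+ n) ⟨
  j                      ∎
  where
  open ℤ.≤-Reasoning
  regroup : ∀ i k → i ≡ i ℤ.+ k ℤ.- k
  regroup = solve-∀

+[m∸n]≡+m-+n : ∀ {m n} → n ≤ m → + (m ∸ n) ≡ + m ℤ.- + n
+[m∸n]≡+m-+n {m} {n} n≤m = trans (sym (ℤ.⊖-≥ n≤m)) (sym (ℤ.m-n≡m⊖n m n))

m<pred[n]⇒suc[m]<n : ∀ {m n} → m < ℕ.pred n → suc m < n
m<pred[n]⇒suc[m]<n {n = suc _} m<n = s≤s m<n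

pred[n]≤m⇒n≤suc[m] : ∀ {m n} → ℕ.pred n ≤ m → n ≤ suc m
pred[n]≤m⇒n≤suc[m] {n = zero}  _   = z≤n
pred[n]≤m⇒n≤suc[m] {n = suc _} n≤m = s≤s n≤m

module _ (f : ℕ → ℤ) (x₀ : ℕ) where

  antitone-upTo : (∀ x → suc x ≤ x₀ → f (suc x) ℤ.≤ f x) → ∀ {x y} → x ≤′ y → y ≤ x₀ → f y ℤ.≤ f x
  antitone-upTo _    ≤′-refl                   _    = ℤ.≤-refl
  antitone-upTo down (≤′-step {n = y} x≤′y) 1+y≤x₀ =
    ℤ.≤-trans (down y 1+y≤x₀) (antitone-upTo down x≤′y (≤-trans (n≤1+n y) 1+y≤x₀))

  monotone-from : (∀ x → x₀ ≤ x → f x ℤ.≤ f (suc x)) → ∀ {x y} → x ≤′ y → x₀ ≤ x → f x ℤ.≤ f y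
  monotone-from _  ≤′-refl                  _    = ℤ.≤-refl
  monotone-from up (≤′-step {n = y} x≤′y) x₀≤x =
    ℤ.≤-trans (monotone-from up x≤′y x₀≤x) (up y (≤-trans x₀≤x (≤′⇒≤ x≤′y)))

  valley : (∀ x → suc x ≤ x₀ → f (suc x) ℤ.≤ f x) → (∀ x → x₀ ≤ x → f x ℤ.≤ f (suc x)) →
           ∀ x → f x₀ ℤ.≤ f x
  valley down up x with ≤-total x x₀
  ... | inj₁ x≤x₀ = antitone-upTo down (≤⇒≤′ x≤x₀) ≤-refl
  ... | inj₂ x₀≤x = monotone-from up (≤⇒≤′ x₀≤x) ≤-refl

⌈n/2⌉∸1+1+⌊n/2⌋≡n : ∀ n → 1 ≤ n → ⌈ n /2⌉ ∸ 1 + suc ⌊ n /2⌋ ≡ n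
⌈n/2⌉∸1+1+⌊n/2⌋≡n n n≥1 = begin
  ⌈ n /2⌉ ∸ 1 + suc ⌊ n /2⌋    ≡⟨ +-suc (⌈ n /2⌉ ∸ 1) ⌊ n /2⌋ ⟩
  suc (⌈ n /2⌉ ∸ 1) + ⌊ n /2⌋  ≡⟨ cong (λ k → k + ⌊ n /2⌋) (m+[n∸m]≡n (⌈n/2⌉-mono n≥1)) ⟩
  ⌈ n /2⌉ + ⌊ n /2⌋            ≡⟨ +-comm ⌈ n /2⌉ ⌊ n /2⌋ ⟩
  ⌊ n /2⌋ + ⌈ n /2⌉            ≡⟨ ⌊n/2⌋+⌈n/2⌉≡n n ⟩
  n                           ∎
  where open ≡-Reasoning

⌈n/2⌉∸1≤⌊n/2⌋ : ∀ n → ⌈ n /2⌉ ∸ 1 ≤ ⌊ n /2⌋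
⌈n/2⌉∸1≤⌊n/2⌋ n = ∸-monoˡ-≤ 1 (⌊n/2⌋-mono (n≤1+n (suc n)))

⌊n/2⌋≤1+[⌈n/2⌉∸1] : ∀ n → ⌊ n /2⌋ ≤ suc (⌈ n /2⌉ ∸ 1)
⌊n/2⌋≤1+[⌈n/2⌉∸1] n = ≤-trans (⌊n/2⌋≤⌈n/2⌉ n) (m≤n+m∸n ⌈ n /2⌉ 1)

+q≡+r*+m-1 : ∀ q r m → q + 1 ≡ r * m → + q ≡ + r ℤ.* + m ℤ.- 1ℤ
+q≡+r*+m-1 q r m q+1≡r*m = begin
  + q                 ≡⟨ regroup (+ q) ⟩
  + (q + 1) ℤ.- 1ℤ     ≡⟨ cong (λ n → + n ℤ.- 1ℤ) q+1≡r*m ⟩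
  + (r * m) ℤ.- 1ℤ     ≡⟨ cong (ℤ._- 1ℤ) (ℤ.pos-* r m) ⟩
  + r ℤ.* + m ℤ.- 1ℤ   ∎
  where
  open ≡-Reasoning
  regroup : ∀ Q → Q ≡ Q ℤ.+ 1ℤ ℤ.- 1ℤ
  regroup = solve-∀

even-closedForm : ∀ {m q r h} → m ≡ suc h + suc h → q + 1 ≡ r * m → 1 ≤ q →
                  (+ h ℤ.* (+ r ℤ.* + suc h ℤ.- 1ℤ)) / 2 ≡ (+ ((m ∸ 2) * (q ∸ 1))) / 8
even-closedForm {q = q} {r} {h} refl q+1≡r*m q≥1 = /-cross lhs (+ ((m ∸ 2) * (q ∸ 1))) 1 7 (begin
  lhs ℤ.* + 8                                        ≡⟨ identity (+ r) (+ h) ⟩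
  (M ℤ.- + 2) ℤ.* (+ r ℤ.* M ℤ.- 1ℤ ℤ.- + 1) ℤ.* + 2
    ≡⟨ cong (λ z → (M ℤ.- + 2) ℤ.* (z ℤ.- + 1) ℤ.* + 2) (+q≡+r*+m-1 q r m q+1≡r*m) ⟨
  (M ℤ.- + 2) ℤ.* (+ q ℤ.- + 1) ℤ.* + 2
    ≡⟨ cong₂ (λ a b → a ℤ.* b ℤ.* + 2) (+[m∸n]≡+m-+n 2≤m) (+[m∸n]≡+m-+n q≥1) ⟨
  + (m ∸ 2) ℤ.* + (q ∸ 1) ℤ.* + 2                     ≡⟨ cong (ℤ._* + 2) (ℤ.pos-* (m ∸ 2) (q ∸ 1)) ⟨
  + ((m ∸ 2) * (q ∸ 1)) ℤ.* + 2                       ∎)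
  where
  open ≡-Reasoning
  lhs : ℤ
  lhs = + h ℤ.* (+ r ℤ.* + suc h ℤ.- 1ℤ)
  m : ℕ
  m = suc h + suc h
  M : ℤ
  M = + m
  2≤m : 2 ≤ m
  2≤m = s≤s (≤-trans (s≤s z≤n) (m≤n+m (suc h) h))
  identity : ∀ R H → let M = (+ 1 ℤ.+ H) ℤ.+ (+ 1 ℤ.+ H) in
             H ℤ.* (R ℤ.* (+ 1 ℤ.+ H) ℤ.- 1ℤ) ℤ.* + 8 ≡ (M ℤ.- + 2) ℤ.* (R ℤ.* M ℤ.- 1ℤ ℤ.- + 1) ℤ.* + 2
  identity = solve-∀

odd-closedForm : ∀ {m q r h} → m ≡ suc (h + h) → q + 1 ≡ r * m →
                 (+ h ℤ.* (+ r ℤ.* + h ℤ.- 1ℤ)) / 2 ≡ ((+ m ℤ.- + 1) ℤ.* (+ q ℤ.- + r ℤ.- + 1)) / 8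
odd-closedForm {q = q} {r} {h} refl q+1≡r*m = /-cross lhs rhs 1 7 (begin
  lhs ℤ.* + 8                                             ≡⟨ identity (+ r) (+ h) ⟩
  (M ℤ.- + 1) ℤ.* (+ r ℤ.* M ℤ.- 1ℤ ℤ.- + r ℤ.- + 1) ℤ.* + 2
    ≡⟨ cong (λ z → (M ℤ.- + 1) ℤ.* (z ℤ.- + r ℤ.- + 1) ℤ.* + 2) (+q≡+r*+m-1 q r (suc (h + h)) q+1≡r*m) ⟨
  rhs ℤ.* + 2                                             ∎)
  where
  open ≡-Reasoning
  M : ℤ
  M = + suc (h + h)
  lhs : ℤ
  lhs = + h ℤ.* (+ r ℤ.* + h ℤ.- 1ℤ)
  rhs : ℤ
  rhs = (M ℤ.- + 1) ℤ.* (+ q ℤ.- + r ℤ.- + 1)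
  identity : ∀ R H → let M = + 1 ℤ.+ (H ℤ.+ H) in
             H ℤ.* (R ℤ.* H ℤ.- 1ℤ) ℤ.* + 8 ≡ (M ℤ.- + 1) ℤ.* (R ℤ.* M ℤ.- 1ℤ ℤ.- R ℤ.- + 1) ℤ.* + 2
  identity = solve-∀

n+n≡n*2 : ∀ n → n + n ≡ n * 2
n+n≡n*2 n = solve (n ∷ [])

2∤1+n+n : ∀ n → ¬ 2 ∣ suc (n + n)
2∤1+n+n n 2∣1+n+n = contradiction (∣1⇒≡1 (∣m+n∣m⇒∣n 2∣n+n+1 (divides n (n+n≡n*2 n)))) λ ()
  where
  2∣n+n+1 : 2 ∣ n + n + 1
  2∣n+n+1 = subst (2 ∣_) (+-comm 1 (n + n)) 2∣1+n+n

module _ (m q : ℕ) where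

  InS⇒representable : ∀ {n} → InS m q n → ∃₂ λ a b → a * m + b * q ≡ n
  InS⇒representable {n} n∈S with Any.satisfied (any⁻ _ (upTo (suc n)) n∈S)
  ... | a , found-b with Any.satisfied (any⁻ _ (upTo (suc n)) found-b)
  ... | b , am+bq≡ᵇn = a , b , ≡ᵇ⇒≡ (a * m + b * q) n am+bq≡ᵇn

  representable⇒InS : 1 ≤ m → 1 ≤ q → ∀ {n} a b → a * m + b * q ≡ n → InS m q n
  representable⇒InS m≥1 q≥1 {n} a b refl =
    any⁺ _ (Any.map (λ { refl → find-b }) (∈-upTo⁺ (s≤s a≤n)))
    where
    a≤n : a ≤ n
    a≤n = ≤-trans (m≤m*n a m {{ℕ.>-nonZero m≥1}}) (m≤m+n (a * m) (b * q))
    b≤n : b ≤ n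
    b≤n = ≤-trans (m≤m*n b q {{ℕ.>-nonZero q≥1}}) (m≤n+m (b * q) (a * m))
    find-b : T (Bool.any (λ b′ → (a * m + b′ * q) ≡ᵇ n) (upTo (suc n)))
    find-b = any⁺ _ (Any.map (λ { refl → ≡⇒≡ᵇ n n refl }) (∈-upTo⁺ (s≤s b≤n)))

  countS-suc : ∀ t → countS m q (suc t) ≡ countS m q t + (if memb m q (suc t) then 1 else 0)
  countS-suc t = begin
    length (filter P? (upTo (suc (suc t))))            ≡⟨ cong (length ∘ filter P?) (sym (upTo-∷ʳ (suc t))) ⟩
    length (filter P? (upTo (suc t) ∷ʳ suc t))          ≡⟨ cong length (filter-++ P? (upTo (suc t)) (suc t ∷ [])) ⟩
    length (filter P? (upTo (suc t)) ++ filter P? (suc t ∷ []))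
                                                       ≡⟨ length-++ (filter P? (upTo (suc t))) ⟩
    countS m q t + length (filter P? (suc t ∷ []))      ≡⟨ cong (λ k → countS m q t + k) last ⟩
    countS m q t + (if memb m q (suc t) then 1 else 0) ∎
    where
    open ≡-Reasoning
    P? : (n : ℕ) → Dec (T (memb m q n))
    P? = λ n → T? (memb m q n)
    last : length (filter P? (suc t ∷ [])) ≡ (if memb m q (suc t) then 1 else 0)
    last with memb m q (suc t)
    ... | true  = refl
    ... | false = refl

  excess : ℕ → ℤ
  excess t = + 2 ℤ.* + countS m q t ℤ.- + t

  excess-suc-∈ : ∀ t → InS m q (suc t) → excess (suc t) ≡ excess t ℤ.+ 1ℤ
  excess-suc-∈ t t∈S with memb m q (suc t) | countS-suc t
  ... | true | count≡ = begin
    + 2 ℤ.* + countS m q (suc t) ℤ.- + suc t  ≡⟨ cong (λ k → + 2 ℤ.* + k ℤ.- + suc t) count≡ ⟩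
    + 2 ℤ.* + (C + 1) ℤ.- (+ 1 ℤ.+ + t)      ≡⟨ cong (λ k → + 2 ℤ.* k ℤ.- (+ 1 ℤ.+ + t)) (ℤ.pos-+ C 1) ⟩
    + 2 ℤ.* (+ C ℤ.+ + 1) ℤ.- (+ 1 ℤ.+ + t)  ≡⟨ rearrange (+ C) (+ t) ⟩
    + 2 ℤ.* + C ℤ.- + t ℤ.+ 1ℤ              ∎
    where
    open ≡-Reasoning
    C : ℕ
    C = countS m q t
    rearrange : ∀ C T → + 2 ℤ.* (C ℤ.+ + 1) ℤ.- (+ 1 ℤ.+ T) ≡ + 2 ℤ.* C ℤ.- T ℤ.+ 1ℤ
    rearrange = solve-∀

  excess-suc-∉ : ∀ t → ¬ InS m q (suc t) → excess (suc t) ≡ excess t ℤ.- 1ℤ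
  excess-suc-∉ t t∉S with memb m q (suc t) | countS-suc t
  ... | true  | _      = contradiction _ t∉S
  ... | false | count≡ = begin
    + 2 ℤ.* + countS m q (suc t) ℤ.- + suc t  ≡⟨ cong (λ k → + 2 ℤ.* + k ℤ.- + suc t) count≡ ⟩
    + 2 ℤ.* + (C + 0) ℤ.- (+ 1 ℤ.+ + t)      ≡⟨ cong (λ k → + 2 ℤ.* + k ℤ.- (+ 1 ℤ.+ + t)) (+-identityʳ C) ⟩
    + 2 ℤ.* + C ℤ.- (+ 1 ℤ.+ + t)            ≡⟨ rearrange (+ C) (+ t) ⟩
    + 2 ℤ.* + C ℤ.- + t ℤ.- 1ℤ              ∎
    where
    open ≡-Reasoning
    C : ℕ
    C = countS m q t
    rearrange : ∀ C T → + 2 ℤ.* C ℤ.- (+ 1 ℤ.+ T) ≡ + 2 ℤ.* C ℤ.- T ℤ.- 1ℤ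
    rearrange = solve-∀

  excess-run-∉ : ∀ t k → (∀ i → i < k → ¬ InS m q (t + suc i)) → excess (t + k) ≡ excess t ℤ.- + k
  excess-run-∉ t zero    _    = trans (cong excess (+-identityʳ t)) (sym (ℤ.+-identityʳ (excess t)))
  excess-run-∉ t (suc k) gaps = begin
    excess (t + suc k)          ≡⟨ cong excess (+-suc t k) ⟩
    excess (suc (t + k))        ≡⟨ excess-suc-∉ (t + k) (subst (¬_ ∘ InS m q) (+-suc t k) (gaps k ≤-refl)) ⟩
    excess (t + k) ℤ.- 1ℤ        ≡⟨ cong (ℤ._- 1ℤ) (excess-run-∉ t k (λ i i<k → gaps i (m<n⇒m<1+n i<k))) ⟩
    excess t ℤ.- + k ℤ.- 1ℤ      ≡⟨ rearrange (excess t) (+ k) ⟩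
    excess t ℤ.- (+ 1 ℤ.+ + k)  ∎
    where
    open ≡-Reasoning
    rearrange : ∀ W K → W ℤ.- K ℤ.- 1ℤ ≡ W ℤ.- (+ 1 ℤ.+ K)
    rearrange = solve-∀

  excess-run-∈ : ∀ t k → (∀ i → i < k → InS m q (t + suc i)) → excess (t + k) ≡ excess t ℤ.+ + k
  excess-run-∈ t zero    _       = trans (cong excess (+-identityʳ t)) (sym (ℤ.+-identityʳ (excess t)))
  excess-run-∈ t (suc k) members = begin
    excess (t + suc k)          ≡⟨ cong excess (+-suc t k) ⟩
    excess (suc (t + k))        ≡⟨ excess-suc-∈ (t + k) (subst (InS m q) (+-suc t k) (members k ≤-refl)) ⟩
    excess (t + k) ℤ.+ 1ℤ        ≡⟨ cong (ℤ._+ 1ℤ) (excess-run-∈ t k (λ i i<k → members i (m<n⇒m<1+n i<k))) ⟩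
    excess t ℤ.+ + k ℤ.+ 1ℤ      ≡⟨ ℤ.+-assoc (excess t) (+ k) 1ℤ ⟩
    excess t ℤ.+ (+ k ℤ.+ 1ℤ)    ≡⟨ cong (λ i → excess t ℤ.+ i) (ℤ.+-comm (+ k) 1ℤ) ⟩
    excess t ℤ.+ (+ 1 ℤ.+ + k)  ∎
    where open ≡-Reasoning

  toℚᵘ-σ : ∀ t → toℚᵘ (σ m q t) ℚᵘ.≃ mkℚᵘ (+ 2 ℤ.- excess t) 1
  toℚᵘ-σ t = ℚᵘ.≃-trans (ℚ.toℚᵘ-homo-+ (+ t / 2 ℚ.- + C / 1) (+ 1 / 1))
    (ℚᵘ.≃-trans (ℚᵘ.+-cong (ℚᵘ.≃-trans (ℚ.toℚᵘ-homo-+ (+ t / 2) (ℚ.- (+ C / 1)))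
       (ℚᵘ.+-cong (ℚ.toℚᵘ-fromℚᵘ (mkℚᵘ (+ t) 1))
          (ℚᵘ.≃-trans (ℚ.toℚᵘ-homo‿- (+ C / 1)) (ℚᵘ.-‿cong (ℚ.toℚᵘ-fromℚᵘ (mkℚᵘ (+ C) 0))))))
     (ℚ.toℚᵘ-fromℚᵘ (mkℚᵘ (+ 1) 0))) (*≡* (rearrange (+ t) (+ C))))
    where
    C : ℕ
    C = countS m q t
    rearrange : ∀ T N → ((T ℤ.* + 1 ℤ.+ (ℤ.- N) ℤ.* + 2) ℤ.* + 1 ℤ.+ + 1 ℤ.* + 2) ℤ.* + 2
                      ≡ (+ 2 ℤ.- (+ 2 ℤ.* N ℤ.- T)) ℤ.* + 2
    rearrange = solve-∀

  σ-antitone : ∀ s t → excess s ℤ.≤ excess t → σ m q t ℚ.≤ σ m q s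
  σ-antitone s t Ws≤Wt = ℚ.toℚᵘ-cancel-≤
    (ℚᵘ.≤-respˡ-≃ (ℚᵘ.≃-sym (toℚᵘ-σ t)) (ℚᵘ.≤-respʳ-≃ (ℚᵘ.≃-sym (toℚᵘ-σ s))
      (*≤* (ℤ.*-monoʳ-≤-nonNeg (+ 2) (ℤ.+-monoʳ-≤ (+ 2) (ℤ.neg-mono-≤ Ws≤Wt))))))

  σ≡ : ∀ t → σ m q t ≡ (+ 2 ℤ.- excess t) / 2
  σ≡ t = ℚ.toℚᵘ-injective
    (ℚᵘ.≃-trans (toℚᵘ-σ t) (ℚᵘ.≃-sym (ℚ.toℚᵘ-fromℚᵘ (mkℚᵘ (+ 2 ℤ.- excess t) 1))))

module Blocks (m q r : ℕ) (m≥1 : 1 ≤ m) (q≥1 : 1 ≤ q) (r≥1 : 1 ≤ r) (q+1≡r*m : q + 1 ≡ r * m) where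

  private instance
    r≢0 : NonZero r
    r≢0 = ℕ.>-nonZero r≥1
    m≢0 : NonZero m
    m≢0 = ℕ.>-nonZero m≥1

  *q-shift : ∀ a b → a * m + b * q + b ≡ (a + b * r) * m
  *q-shift a b = begin
    a * m + b * q + b    ≡⟨ solve (a ∷ m ∷ b ∷ q ∷ []) ⟩
    a * m + b * (q + 1)  ≡⟨ cong (λ n → a * m + b * n) q+1≡r*m ⟩
    a * m + b * (r * m)  ≡⟨ solve (a ∷ m ∷ b ∷ r ∷ []) ⟩
    (a + b * r) * m      ∎
    where open ≡-Reasoning

  ∈-block⇐ : ∀ x y j → y + j ≡ m → y * r ≤ suc x → InS m q (x * m + j)
  ∈-block⇐ x y j y+j≡m y*r≤1+x =
    representable⇒InS m q m≥1 q≥1 a y (+-cancelʳ-≡ y (a * m + y * q) (x * m + j) (begin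
      a * m + y * q + y    ≡⟨ *q-shift a y ⟩
      (a + y * r) * m      ≡⟨ cong (_* m) (m∸n+n≡m y*r≤1+x) ⟩
      suc x * m            ≡⟨ cong (suc x *_) (sym y+j≡m) ⟩
      suc x * (y + j)      ≡⟨ solve (x ∷ y ∷ j ∷ []) ⟩
      x * (y + j) + j + y  ≡⟨ cong (λ n → x * n + j + y) y+j≡m ⟩
      x * m + j + y        ∎))
    where
    open ≡-Reasoning
    a : ℕ
    a = suc x ∸ y * r

  -- A representation a*m + b*q of x*m + j must use b = y + o*m copies of q, where
  -- suc x + o = a + b*r; this forces y*r ≤ suc x.
  ∈-block⇒ : ∀ x y j → y + j ≡ m → 1 ≤ j → InS m q (x * m + j) → y * r ≤ suc x
  ∈-block⇒ x y j y+j≡m j≥1 x*m+j∈S with InS⇒representable m q x*m+j∈S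
  ... | a , b , am+bq≡ = y*r≤1+x (A ∸ suc x) (m+[n∸m]≡n x<A)
    where
    open ≤-Reasoning
    A : ℕ
    A = a + b * r
    A*m≡ : A * m ≡ x * m + j + b
    A*m≡ = trans (sym (*q-shift a b)) (cong (λ n → n + b) am+bq≡)
    x<A : x < A
    x<A = *-cancelʳ-< m x A (begin-strict
      x * m          <⟨ m<m+n (x * m) j≥1 ⟩
      x * m + j      ≤⟨ m≤m+n (x * m + j) b ⟩
      x * m + j + b  ≡⟨ sym A*m≡ ⟩
      A * m          ∎)
    y*r≤1+x : ∀ o → suc x + o ≡ A → y * r ≤ suc x
    y*r≤1+x o 1+x+o≡A = +-cancelʳ-≤ o (y * r) (suc x) (begin
      y * r + o                  ≤⟨ +-monoʳ-≤ (y * r) (≤-trans o≤o*[m*r] (m≤m+n _ a)) ⟩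
      y * r + (o * (m * r) + a)  ≡⟨ solve (y ∷ r ∷ o ∷ m ∷ a ∷ []) ⟩
      a + (y + o * m) * r        ≡⟨ cong (λ n → a + n * r) (sym b≡y+o*m) ⟩
      A                          ≡⟨ sym 1+x+o≡A ⟩
      suc x + o                  ∎)
      where
      b≡y+o*m : b ≡ y + o * m
      b≡y+o*m = +-cancelˡ-≡ (x * m + j) b (y + o * m) (begin-equality
        x * m + j + b            ≡⟨ sym A*m≡ ⟩
        A * m                    ≡⟨ cong (_* m) (sym 1+x+o≡A) ⟩
        (suc x + o) * m          ≡⟨ solve (x ∷ o ∷ m ∷ []) ⟩
        x * m + m + o * m        ≡⟨ cong (λ n → x * m + n + o * m) (sym y+j≡m) ⟩
        x * m + (y + j) + o * m  ≡⟨ solve (x ∷ m ∷ y ∷ j ∷ o ∷ []) ⟩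
        x * m + j + (y + o * m)  ∎)
      o≤o*[m*r] : o ≤ o * (m * r)
      o≤o*[m*r] = m≤m*n o (m * r) {{ℕ.>-nonZero (*-mono-≤ m≥1 r≥1)}}

  -- Block x is x*m + 1, …, x*m + m: it begins with ℓ x gaps, and the rest of it lies in S.
  ℓ : ℕ → ℕ
  ℓ x = (m ∸ 1) ∸ suc x ℕ./ r

  private
    m∸1≡ : ∀ {y i} → y + suc i ≡ m → m ∸ 1 ≡ i + y
    m∸1≡ {y} {i} y+1+i≡m = trans (cong (_∸ 1) (sym y+1+i≡m)) (trans (cong (_∸ 1) (+-suc y i)) (+-comm y i))

  ℓ<⇒*r≤ : ∀ x y j → y + j ≡ m → ℓ x < j → y * r ≤ suc x
  ℓ<⇒*r≤ x y (suc i) y+j≡m (s≤s ℓx≤i) = m≤n/o⇒m*o≤n (+-cancelˡ-≤ i y K (begin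
    i + y              ≤⟨ m≤n+m∸n (i + y) K ⟩
    K + (i + y ∸ K)    ≤⟨ +-monoʳ-≤ K (subst (λ n → n ∸ K ≤ i) (m∸1≡ y+j≡m) ℓx≤i) ⟩
    K + i              ≡⟨ +-comm K i ⟩
    i + K              ∎))
    where
    open ≤-Reasoning
    K : ℕ
    K = suc x ℕ./ r

  *r≤⇒ℓ< : ∀ x y j → y + j ≡ m → 1 ≤ j → y * r ≤ suc x → ℓ x < j
  *r≤⇒ℓ< x y (suc i) y+j≡m _ y*r≤1+x = s≤s (subst (λ n → n ∸ K ≤ i) (sym (m∸1≡ y+j≡m))
    (m≤n+o⇒m∸n≤o (i + y) K (begin
      i + y  ≡⟨ +-comm i y ⟩
      y + i  ≤⟨ +-monoˡ-≤ i (m*o≤n⇒m≤n/o y*r≤1+x) ⟩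
      K + i  ∎)))
    where
    open ≤-Reasoning
    K : ℕ
    K = suc x ℕ./ r

  ℓ≡ : ∀ x y v → y + suc v ≡ m → y * r ≤ suc x → suc x < suc y * r → ℓ x ≡ v
  ℓ≡ x y v y+1+v≡m y*r≤1+x 1+x<[1+y]*r = ≤-antisym
    (s≤s⁻¹ (*r≤⇒ℓ< x y (suc v) y+1+v≡m (s≤s z≤n) y*r≤1+x))
    (≮⇒≥ λ ℓx<v → <⇒≱ 1+x<[1+y]*r (ℓ<⇒*r≤ x (suc y) v (trans (sym (+-suc y v)) y+1+v≡m) ℓx<v))

  ℓ<⇒∈ : ∀ x j → ℓ x < j → j ≤ m → InS m q (x * m + j)
  ℓ<⇒∈ x j ℓx<j j≤m = ∈-block⇐ x (m ∸ j) j y+j≡m (ℓ<⇒*r≤ x (m ∸ j) j y+j≡m ℓx<j)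
    where y+j≡m = m∸n+n≡m j≤m

  ∈⇒ℓ< : ∀ x j → 1 ≤ j → j ≤ m → InS m q (x * m + j) → ℓ x < j
  ∈⇒ℓ< x j j≥1 j≤m x*m+j∈S =
    *r≤⇒ℓ< x (m ∸ j) j y+j≡m j≥1 (∈-block⇒ x (m ∸ j) j y+j≡m j≥1 x*m+j∈S)
    where y+j≡m = m∸n+n≡m j≤m

  ℓ<m : ∀ x → ℓ x < m
  ℓ<m x = *r≤⇒ℓ< x 0 m refl m≥1 z≤n

  startExcess : ℕ → ℤ
  startExcess x = excess m q (x * m)

  -- The excess at the first element of S in block x, the least excess over S ∩ block x.
  minExcess : ℕ → ℤ
  minExcess x = excess m q (x * m + suc (ℓ x))

  excess-gaps : ∀ x j → j ≤ ℓ x → excess m q (x * m + j) ≡ startExcess x ℤ.- + j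
  excess-gaps x j j≤ℓx = excess-run-∉ m q (x * m) j gap
    where
    gap : ∀ i → i < j → ¬ InS m q (x * m + suc i)
    gap i i<j ∈S = <⇒≱ (∈⇒ℓ< x (suc i) (s≤s z≤n) 1+i≤m ∈S) (≤-trans i<j j≤ℓx)
      where 1+i≤m = ≤-trans i<j (≤-trans j≤ℓx (<⇒≤ (ℓ<m x)))

  minExcess+ℓ : ∀ x → minExcess x ℤ.+ + ℓ x ≡ startExcess x ℤ.+ 1ℤ
  minExcess+ℓ x = begin
    minExcess x ℤ.+ + ℓ x                        ≡⟨ cong (λ e → e ℤ.+ + ℓ x) first-member ⟩
    excess m q (x * m + ℓ x) ℤ.+ 1ℤ ℤ.+ + ℓ x    ≡⟨ cong (λ e → e ℤ.+ 1ℤ ℤ.+ + ℓ x) (excess-gaps x (ℓ x) ≤-refl) ⟩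
    startExcess x ℤ.- + ℓ x ℤ.+ 1ℤ ℤ.+ + ℓ x      ≡⟨ regroup (startExcess x) (+ ℓ x) ⟩
    startExcess x ℤ.+ 1ℤ                          ∎
    where
    open ≡-Reasoning
    first-member : minExcess x ≡ excess m q (x * m + ℓ x) ℤ.+ 1ℤ
    first-member = trans (cong (excess m q) (+-suc (x * m) (ℓ x)))
      (excess-suc-∈ m q (x * m + ℓ x) (subst (InS m q) (+-suc (x * m) (ℓ x)) (ℓ<⇒∈ x (suc (ℓ x)) ≤-refl (ℓ<m x))))
    regroup : ∀ P L → P ℤ.- L ℤ.+ 1ℤ ℤ.+ L ≡ P ℤ.+ 1ℤ
    regroup = solve-∀

  excess-members : ∀ x k → suc (ℓ x) + k ≤ m → excess m q (x * m + suc (ℓ x) + k) ≡ minExcess x ℤ.+ + k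
  excess-members x k ℓx<m-k = excess-run-∈ m q (x * m + suc (ℓ x)) k member
    where
    member : ∀ i → i < k → InS m q (x * m + suc (ℓ x) + suc i)
    member i i<k = subst (InS m q) (sym (+-assoc (x * m) (suc (ℓ x)) (suc i)))
      (ℓ<⇒∈ x (suc (ℓ x) + suc i) (s≤s (m≤m+n (ℓ x) (suc i))) (≤-trans (+-monoʳ-≤ (suc (ℓ x)) i<k) ℓx<m-k))

  minExcess≤excess : ∀ x j → 1 ≤ j → j ≤ m → InS m q (x * m + j) → minExcess x ℤ.≤ excess m q (x * m + j)
  minExcess≤excess x j j≥1 j≤m x*m+j∈S = begin
    minExcess x                               ≤⟨ ℤ.i≤i+j (minExcess x) (+ k) ⟩
    minExcess x ℤ.+ + k                       ≡⟨ excess-members x k (≤-trans (≤-reflexive 1+ℓx+k≡j) j≤m) ⟨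
    excess m q (x * m + suc (ℓ x) + k)        ≡⟨ cong (excess m q) (+-assoc (x * m) (suc (ℓ x)) k) ⟩
    excess m q (x * m + (suc (ℓ x) + k))      ≡⟨ cong (λ n → excess m q (x * m + n)) 1+ℓx+k≡j ⟩
    excess m q (x * m + j)                    ∎
    where
    open ℤ.≤-Reasoning
    ℓx<j : ℓ x < j
    ℓx<j = ∈⇒ℓ< x j j≥1 j≤m x*m+j∈S
    k : ℕ
    k = j ∸ suc (ℓ x)
    1+ℓx+k≡j : suc (ℓ x) + k ≡ j
    1+ℓx+k≡j = m+[n∸m]≡n ℓx<j

  startExcess-suc≡minExcess+ : ∀ x k → suc (ℓ x) + k ≡ m → startExcess (suc x) ≡ minExcess x ℤ.+ + k
  startExcess-suc≡minExcess+ x k 1+ℓx+k≡m = begin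
    excess m q (m + x * m)               ≡⟨ cong (excess m q) (trans (+-comm m (x * m)) (cong (λ n → x * m + n) (sym 1+ℓx+k≡m))) ⟩
    excess m q (x * m + (suc (ℓ x) + k)) ≡⟨ cong (excess m q) (sym (+-assoc (x * m) (suc (ℓ x)) k)) ⟩
    excess m q (x * m + suc (ℓ x) + k)   ≡⟨ excess-members x k (≤-reflexive 1+ℓx+k≡m) ⟩
    minExcess x ℤ.+ + k                  ∎
    where open ≡-Reasoning

  startExcess-suc : ∀ x k → suc (ℓ x) + k ≡ m → startExcess (suc x) ≡ startExcess x ℤ.+ + suc k ℤ.- + ℓ x
  startExcess-suc x k 1+ℓx+k≡m = begin
    startExcess (suc x)                        ≡⟨ startExcess-suc≡minExcess+ x k 1+ℓx+k≡m ⟩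
    minExcess x ℤ.+ + k                        ≡⟨ regroup (minExcess x) (+ ℓ x) (+ k) ⟩
    minExcess x ℤ.+ + ℓ x ℤ.+ + k ℤ.- + ℓ x    ≡⟨ cong (λ e → e ℤ.+ + k ℤ.- + ℓ x) (minExcess+ℓ x) ⟩
    startExcess x ℤ.+ 1ℤ ℤ.+ + k ℤ.- + ℓ x     ≡⟨ cong (ℤ._- + ℓ x) (ℤ.+-assoc (startExcess x) 1ℤ (+ k)) ⟩
    startExcess x ℤ.+ + suc k ℤ.- + ℓ x        ∎
    where
    open ≡-Reasoning
    regroup : ∀ V L K → V ℤ.+ K ≡ V ℤ.+ L ℤ.+ K ℤ.- L
    regroup = solve-∀

  minExcess-suc : ∀ x k → suc (ℓ x) + k ≡ m → minExcess (suc x) ℤ.+ + ℓ (suc x) ≡ minExcess x ℤ.+ + suc k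
  minExcess-suc x k 1+ℓx+k≡m = begin
    minExcess (suc x) ℤ.+ + ℓ (suc x)  ≡⟨ minExcess+ℓ (suc x) ⟩
    startExcess (suc x) ℤ.+ 1ℤ         ≡⟨ cong (ℤ._+ 1ℤ) (startExcess-suc≡minExcess+ x k 1+ℓx+k≡m) ⟩
    minExcess x ℤ.+ + k ℤ.+ 1ℤ          ≡⟨ ℤ.+-assoc (minExcess x) (+ k) 1ℤ ⟩
    minExcess x ℤ.+ + (k + 1)          ≡⟨ cong (λ n → minExcess x ℤ.+ + n) (+-comm k 1) ⟩
    minExcess x ℤ.+ + suc k            ∎
    where open ≡-Reasoning

  -- On a run of blocks x = j*r, …, j*r + r′ one has ℓ x = m − 1 − j, except at the last one,
  -- where ℓ is one smaller.
  private
    r′ : ℕ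
    r′ = r ∸ 1

    1+r′≡r : suc r′ ≡ r
    1+r′≡r = m+[n∸m]≡n r≥1

    runEnd+1≡ : ∀ j → suc (j * r + r′) ≡ suc j * r
    runEnd+1≡ j = trans (sym (+-suc (j * r) r′)) (trans (cong (λ n → j * r + n) 1+r′≡r) (+-comm (j * r) r))

  ℓ-runEnd : ∀ j v → suc j + suc v ≡ m → ℓ (j * r + r′) ≡ v
  ℓ-runEnd j v 1+j+1+v≡m = ℓ≡ (j * r + r′) (suc j) v 1+j+1+v≡m (≤-reflexive (sym (runEnd+1≡ j)))
    (subst (_< r + suc j * r) (sym (runEnd+1≡ j)) (m<n+m (suc j * r) r≥1))

  startExcess-inRun : ∀ j v → suc j + suc v ≡ m → ∀ i → i < r →
                      startExcess (j * r + i) ≡ startExcess (j * r) ℤ.+ + i ℤ.* (+ j ℤ.- + v)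
  startExcess-inRun j v 1+j+1+v≡m zero _ = begin
    startExcess (j * r + 0)           ≡⟨ cong startExcess (+-identityʳ (j * r)) ⟩
    startExcess (j * r)               ≡⟨ regroup (startExcess (j * r)) (+ j ℤ.- + v) ⟨
    startExcess (j * r) ℤ.+ + 0 ℤ.* (+ j ℤ.- + v) ∎
    where
    open ≡-Reasoning
    regroup : ∀ P D → P ℤ.+ + 0 ℤ.* D ≡ P
    regroup = solve-∀
  startExcess-inRun j v 1+j+1+v≡m (suc i) 1+i<r = begin
    startExcess (j * r + suc i)                             ≡⟨ cong startExcess (+-suc (j * r) i) ⟩
    startExcess (suc (j * r + i))                           ≡⟨ startExcess-suc (j * r + i) j 1+ℓ+j≡m ⟩
    startExcess (j * r + i) ℤ.+ + suc j ℤ.- + ℓ (j * r + i)  ≡⟨ cong₂ (λ e l → e ℤ.+ + suc j ℤ.- + l) previous ℓ≡1+v ⟩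
    P ℤ.+ + i ℤ.* (+ j ℤ.- + v) ℤ.+ + suc j ℤ.- + suc v      ≡⟨ regroup P (+ i) (+ j) (+ v) ⟩
    P ℤ.+ + suc i ℤ.* (+ j ℤ.- + v)                         ∎
    where
    open ≡-Reasoning
    P : ℤ
    P = startExcess (j * r)
    previous : startExcess (j * r + i) ≡ P ℤ.+ + i ℤ.* (+ j ℤ.- + v)
    previous = startExcess-inRun j v 1+j+1+v≡m i (<⇒≤ 1+i<r)
    ℓ≡1+v : ℓ (j * r + i) ≡ suc v
    ℓ≡1+v = ℓ≡ (j * r + i) j (suc v) (trans (+-suc j (suc v)) 1+j+1+v≡m)
      (≤-trans (m≤m+n (j * r) i) (n≤1+n (j * r + i)))
      (subst (_< r + j * r) (+-suc (j * r) i) (subst (j * r + suc i <_) (+-comm (j * r) r) (+-monoʳ-< (j * r) 1+i<r)))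
    1+ℓ+j≡m : suc (ℓ (j * r + i)) + j ≡ m
    1+ℓ+j≡m = trans (cong (λ l → suc l + j) ℓ≡1+v) (trans (+-comm (suc (suc v)) j) (trans (+-suc j (suc v)) 1+j+1+v≡m))
    regroup : ∀ P I J V → P ℤ.+ I ℤ.* (J ℤ.- V) ℤ.+ (+ 1 ℤ.+ J) ℤ.- (+ 1 ℤ.+ V) ≡ P ℤ.+ (+ 1 ℤ.+ I) ℤ.* (J ℤ.- V)
    regroup = solve-∀

  startExcess-nextRun : ∀ j v → suc j + suc v ≡ m →
                        startExcess (suc j * r) ≡ startExcess (j * r) ℤ.+ + r ℤ.* (+ j ℤ.- + v) ℤ.+ + 2
  startExcess-nextRun j v 1+j+1+v≡m = begin
    startExcess (suc j * r)                                          ≡⟨ cong startExcess (runEnd+1≡ j) ⟨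
    startExcess (suc (j * r + r′))                                   ≡⟨ startExcess-suc (j * r + r′) (suc j) 1+ℓ+1+j≡m ⟩
    startExcess (j * r + r′) ℤ.+ + suc (suc j) ℤ.- + ℓ (j * r + r′)  ≡⟨ cong₂ (λ e l → e ℤ.+ + suc (suc j) ℤ.- + l) inRun ℓ≡v ⟩
    P ℤ.+ + r′ ℤ.* (+ j ℤ.- + v) ℤ.+ + suc (suc j) ℤ.- + v            ≡⟨ regroup P (+ r′) (+ j) (+ v) ⟩
    P ℤ.+ + suc r′ ℤ.* (+ j ℤ.- + v) ℤ.+ + 2                         ≡⟨ cong (λ n → P ℤ.+ + n ℤ.* (+ j ℤ.- + v) ℤ.+ + 2) 1+r′≡r ⟩
    P ℤ.+ + r ℤ.* (+ j ℤ.- + v) ℤ.+ + 2                              ∎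
    where
    open ≡-Reasoning
    P : ℤ
    P = startExcess (j * r)
    inRun : startExcess (j * r + r′) ≡ P ℤ.+ + r′ ℤ.* (+ j ℤ.- + v)
    inRun = startExcess-inRun j v 1+j+1+v≡m r′ (subst (r′ <_) 1+r′≡r (n<1+n r′))
    ℓ≡v : ℓ (j * r + r′) ≡ v
    ℓ≡v = ℓ-runEnd j v 1+j+1+v≡m
    1+ℓ+1+j≡m : suc (ℓ (j * r + r′)) + suc j ≡ m
    1+ℓ+1+j≡m = trans (cong (λ l → suc l + suc j) ℓ≡v) (trans (+-comm (suc v) (suc j)) 1+j+1+v≡m)
    regroup : ∀ P R′ J V → P ℤ.+ R′ ℤ.* (J ℤ.- V) ℤ.+ (+ 2 ℤ.+ J) ℤ.- V ≡ P ℤ.+ (+ 1 ℤ.+ R′) ℤ.* (J ℤ.- V) ℤ.+ + 2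
    regroup = solve-∀

  startExcess-runStart : ∀ j v → j + suc v ≡ m → startExcess (j * r) ≡ + 2 ℤ.+ + 2 ℤ.* + j ℤ.- + r ℤ.* + j ℤ.* + v
  startExcess-runStart zero v _ = regroup (+ r) (+ v)
    where
    regroup : ∀ R V → + 2 ≡ + 2 ℤ.+ + 2 ℤ.* + 0 ℤ.- R ℤ.* + 0 ℤ.* V
    regroup = solve-∀
  startExcess-runStart (suc j) v 1+j+1+v≡m = begin
    startExcess (suc j * r)                                    ≡⟨ startExcess-nextRun j v 1+j+1+v≡m ⟩
    startExcess (j * r) ℤ.+ + r ℤ.* (+ j ℤ.- + v) ℤ.+ + 2       ≡⟨ cong (λ e → e ℤ.+ + r ℤ.* (+ j ℤ.- + v) ℤ.+ + 2) previous ⟩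
    + 2 ℤ.+ + 2 ℤ.* + j ℤ.- + r ℤ.* + j ℤ.* + suc v ℤ.+ + r ℤ.* (+ j ℤ.- + v) ℤ.+ + 2
                                                               ≡⟨ regroup (+ r) (+ j) (+ v) ⟩
    + 2 ℤ.+ + 2 ℤ.* + suc j ℤ.- + r ℤ.* + suc j ℤ.* + v         ∎
    where
    open ≡-Reasoning
    previous : startExcess (j * r) ≡ + 2 ℤ.+ + 2 ℤ.* + j ℤ.- + r ℤ.* + j ℤ.* + suc v
    previous = startExcess-runStart j (suc v) (trans (+-suc j (suc v)) 1+j+1+v≡m)
    regroup : ∀ R J V → + 2 ℤ.+ + 2 ℤ.* J ℤ.- R ℤ.* J ℤ.* (+ 1 ℤ.+ V) ℤ.+ R ℤ.* (J ℤ.- V) ℤ.+ + 2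
                       ≡ + 2 ℤ.+ + 2 ℤ.* (+ 1 ℤ.+ J) ℤ.- R ℤ.* (+ 1 ℤ.+ J) ℤ.* V
    regroup = solve-∀

  *q≡runEnd : ∀ y v → suc y + suc v ≡ m → suc y * q ≡ (y * r + r′) * m + suc v
  *q≡runEnd y v 1+y+1+v≡m = +-cancelʳ-≡ (suc y) (suc y * q) (x * m + suc v) (begin
    suc y * q + suc y          ≡⟨ *q-shift 0 (suc y) ⟩
    suc y * r * m              ≡⟨ cong (_* m) (runEnd+1≡ y) ⟨
    suc x * m                  ≡⟨ +-comm m (x * m) ⟩
    x * m + m                  ≡⟨ cong (λ n → x * m + n) (trans (+-comm (suc v) (suc y)) 1+y+1+v≡m) ⟨
    x * m + (suc v + suc y)    ≡⟨ +-assoc (x * m) (suc v) (suc y) ⟨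
    x * m + suc v + suc y      ∎)
    where
    open ≡-Reasoning
    x : ℕ
    x = y * r + r′

  excess-*q≡minExcess : ∀ y v → suc y + suc v ≡ m → excess m q (suc y * q) ≡ minExcess (y * r + r′)
  excess-*q≡minExcess y v 1+y+1+v≡m = cong (excess m q) (trans (*q≡runEnd y v 1+y+1+v≡m)
    (cong (λ l → (y * r + r′) * m + suc l) (sym (ℓ-runEnd y v 1+y+1+v≡m))))

  excess-*q : ∀ y v → y + suc v ≡ m → excess m q (y * q) ≡ + 2 ℤ.- + y ℤ.* (+ r ℤ.* + v ℤ.- 1ℤ)
  excess-*q zero v _ = regroup (+ r) (+ v)
    where
    regroup : ∀ R V → + 2 ≡ + 2 ℤ.- + 0 ℤ.* (R ℤ.* V ℤ.- 1ℤ)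
    regroup = solve-∀
  excess-*q (suc y) v 1+y+1+v≡m = begin
    excess m q (suc y * q)                       ≡⟨ excess-*q≡minExcess y v 1+y+1+v≡m ⟩
    minExcess x                                  ≡⟨ regroup₁ (minExcess x) (+ suc y) ⟩
    minExcess x ℤ.+ + suc y ℤ.- + suc y          ≡⟨ cong (ℤ._- + suc y) (startExcess-suc≡minExcess+ x (suc y) 1+ℓx+1+y≡m) ⟨
    startExcess (suc x) ℤ.- + suc y              ≡⟨ cong (λ z → excess m q (z * m) ℤ.- + suc y) (runEnd+1≡ y) ⟩
    startExcess (suc y * r) ℤ.- + suc y          ≡⟨ cong (ℤ._- + suc y) (startExcess-runStart (suc y) v 1+y+1+v≡m) ⟩
    + 2 ℤ.+ + 2 ℤ.* + suc y ℤ.- + r ℤ.* + suc y ℤ.* + v ℤ.- + suc y ≡⟨ regroup₂ (+ r) (+ y) (+ v) ⟩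
    + 2 ℤ.- + suc y ℤ.* (+ r ℤ.* + v ℤ.- 1ℤ)      ∎
    where
    open ≡-Reasoning
    x : ℕ
    x = y * r + r′
    1+ℓx+1+y≡m : suc (ℓ x) + suc y ≡ m
    1+ℓx+1+y≡m = trans (cong (λ l → suc l + suc y) (ℓ-runEnd y v 1+y+1+v≡m))
      (trans (+-comm (suc v) (suc y)) 1+y+1+v≡m)
    regroup₁ : ∀ V K → V ≡ V ℤ.+ K ℤ.- K
    regroup₁ = solve-∀
    regroup₂ : ∀ R Y V → + 2 ℤ.+ + 2 ℤ.* (+ 1 ℤ.+ Y) ℤ.- R ℤ.* (+ 1 ℤ.+ Y) ℤ.* V ℤ.- (+ 1 ℤ.+ Y)
                        ≡ + 2 ℤ.- (+ 1 ℤ.+ Y) ℤ.* (R ℤ.* V ℤ.- 1ℤ)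
    regroup₂ = solve-∀

  excess-*q≤minExcess : ∀ h c → h + suc c ≡ m → c ≤ suc h → excess m q (h * q) ℤ.≤ minExcess (ℕ.pred (h * r))
  excess-*q≤minExcess zero    c 1+c≡m c≤1 = +-offset-≤ (sym (minExcess+ℓ 0)) ℓ0≤1
    where ℓ0≤1 = ≤-trans (s≤s⁻¹ (subst (ℓ 0 <_) (sym 1+c≡m) (ℓ<m 0))) c≤1
  excess-*q≤minExcess (suc h) c 1+h+1+c≡m _ = ℤ.≤-reflexive (trans (excess-*q≡minExcess h c 1+h+1+c≡m)
    (cong (minExcess ∘ ℕ.pred) (runEnd+1≡ h)))

  excess-*q≤2 : ∀ h c → h + suc c ≡ m → h ≤ c → excess m q (h * q) ℤ.≤ + 2
  excess-*q≤2 zero    _ _ _ = ℤ.≤-refl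
  excess-*q≤2 (suc h) c 1+h+1+c≡m 1+h≤c = begin
    excess m q (suc h * q)                    ≡⟨ excess-*q (suc h) c 1+h+1+c≡m ⟩
    + 2 ℤ.- + suc h ℤ.* (+ r ℤ.* + c ℤ.- 1ℤ)    ≡⟨ cong (λ d → + 2 ℤ.- + suc h ℤ.* (d ℤ.- 1ℤ)) (ℤ.pos-* r c) ⟨
    + 2 ℤ.- + suc h ℤ.* (+ (r * c) ℤ.- 1ℤ)     ≡⟨ cong (λ d → + 2 ℤ.- + suc h ℤ.* d) (+[m∸n]≡+m-+n 1≤r*c) ⟨
    + 2 ℤ.- + suc h ℤ.* + (r * c ∸ 1)         ≡⟨ cong (λ d → + 2 ℤ.- d) (ℤ.pos-* (suc h) (r * c ∸ 1)) ⟨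
    + 2 ℤ.- + (suc h * (r * c ∸ 1))           ≤⟨ ℤ.i-j≤i (+ 2) (+ (suc h * (r * c ∸ 1))) ⟩
    + 2                                       ∎
    where
    open ℤ.≤-Reasoning
    1≤r*c : 1 ≤ r * c
    1≤r*c = *-mono-≤ r≥1 (≤-trans (s≤s z≤n) 1+h≤c)

  *q≤F+1 : ∀ h c F → h + suc c ≡ m → h ≤ c → IsFrobenius m q F → h * q ≤ F + 1
  *q≤F+1 zero    _ _ _ _ _ = z≤n
  *q≤F+1 (suc h) c F 1+h+1+c≡m 1+h≤c (_ , beyond-F∈S) = begin
    suc h * q        ≡⟨ *q≡runEnd h c 1+h+1+c≡m ⟩
    x * m + suc c    ≡⟨ +-suc (x * m) c ⟩
    suc (x * m + c)  ≤⟨ s≤s (≮⇒≥ (λ F<gap → gap (beyond-F∈S _ F<gap))) ⟩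
    suc F            ≡⟨ +-comm 1 F ⟩
    F + 1            ∎
    where
    open ≤-Reasoning
    x : ℕ
    x = h * r + r′
    c≤m : c ≤ m
    c≤m = ≤-trans (n≤1+n c) (≤-trans (m≤n+m (suc c) (suc h)) (≤-reflexive 1+h+1+c≡m))
    gap : ¬ InS m q (x * m + c)
    gap x*m+c∈S = <-irrefl (ℓ-runEnd h c 1+h+1+c≡m) (∈⇒ℓ< x c (≤-trans (s≤s z≤n) 1+h≤c) c≤m x*m+c∈S)

  σ-*q : ∀ y v → y + suc v ≡ m → σ m q (y * q) ≡ (+ y ℤ.* (+ r ℤ.* + v ℤ.- 1ℤ)) / 2
  σ-*q y v y+1+v≡m = begin
    σ m q (y * q)                      ≡⟨ σ≡ m q (y * q) ⟩
    (+ 2 ℤ.- excess m q (y * q)) / 2   ≡⟨ cong (λ e → (+ 2 ℤ.- e) / 2) (excess-*q y v y+1+v≡m) ⟩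
    (+ 2 ℤ.- (+ 2 ℤ.- Z)) / 2          ≡⟨ cong (λ e → e / 2) (regroup (+ 2) Z) ⟩
    Z / 2                              ∎
    where
    open ≡-Reasoning
    Z : ℤ
    Z = + y ℤ.* (+ r ℤ.* + v ℤ.- 1ℤ)
    regroup : ∀ A Z → A ℤ.- (A ℤ.- Z) ≡ Z
    regroup = solve-∀

  σ-*q-even : ∀ h → h + suc (suc h) ≡ m → σ m q (h * q) ≡ (+ ((m ∸ 2) * (q ∸ 1))) / 8
  σ-*q-even h h+2+h≡m = trans (σ-*q h (suc h) h+2+h≡m)
    (even-closedForm {m} {q} {r} {h} (trans (sym h+2+h≡m) (+-suc h (suc h))) q+1≡r*m q≥1)

  σ-*q-odd : ∀ h → h + suc h ≡ m → σ m q (h * q) ≡ ((+ m -ℤ + 1) *ℤ (+ q -ℤ + r -ℤ + 1)) / 8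
  σ-*q-odd h h+1+h≡m = trans (σ-*q h h h+1+h≡m) (odd-closedForm {m} {q} {r} {h} (trans (sym h+1+h≡m) (+-suc h h)) q+1≡r*m)

  σ-*q-byParity : ∀ h c → h + suc c ≡ m → c ≡ h ⊎ c ≡ suc h →
                  (2 ∣ m → σ m q (h * q) ≡ (+ ((m ∸ 2) * (q ∸ 1))) / 8) ×
                  (¬ 2 ∣ m → σ m q (h * q) ≡ ((+ m -ℤ + 1) *ℤ (+ q -ℤ + r -ℤ + 1)) / 8)
  σ-*q-byParity h .h h+1+h≡m (inj₁ refl) =
    (λ 2∣m → contradiction (subst (2 ∣_) (trans (sym h+1+h≡m) (+-suc h h)) 2∣m) (2∤1+n+n h)) ,
    (λ _ → σ-*q-odd h h+1+h≡m)
  σ-*q-byParity h .(suc h) h+2+h≡m (inj₂ refl) =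
    (λ _ → σ-*q-even h h+2+h≡m) ,
    (λ 2∤m → contradiction (divides (suc h) (trans (sym h+2+h≡m) (trans (+-suc h (suc h)) (n+n≡n*2 (suc h))))) 2∤m)

  -- m − 1 = h + c split as evenly as possible.  minExcess decreases up to x₀ = h*r − 1 and increases
  -- from there on, since ℓ x + ℓ (x + 1) ≥ m before x₀ and ≤ m after it.
  module Balanced (h c : ℕ) (h+1+c≡m : h + suc c ≡ m) (h≤c : h ≤ c) (c≤1+h : c ≤ suc h) where

    private
      x₀ : ℕ
      x₀ = ℕ.pred (h * r)

      c<ℓ : ∀ x → suc x < h * r → c < ℓ x
      c<ℓ x 1+x<h*r = ≰⇒> λ ℓx≤c → <⇒≱ 1+x<h*r (ℓ<⇒*r≤ x h (suc c) h+1+c≡m (s≤s ℓx≤c))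

      c≤ℓ : ∀ x → suc x < suc h * r → c ≤ ℓ x
      c≤ℓ x 1+x<[1+h]*r = ≮⇒≥ λ ℓx<c → <⇒≱ 1+x<[1+h]*r (ℓ<⇒*r≤ x (suc h) c (trans (sym (+-suc h c)) h+1+c≡m) ℓx<c)

      ℓ≤c : ∀ x → h * r ≤ suc x → ℓ x ≤ c
      ℓ≤c x h*r≤1+x = s≤s⁻¹ (*r≤⇒ℓ< x h (suc c) h+1+c≡m (s≤s z≤n) h*r≤1+x)

    minExcess-antitone : ∀ x → suc x ≤ x₀ → minExcess (suc x) ℤ.≤ minExcess x
    minExcess-antitone x 1+x≤x₀ = +-offset-≤ (minExcess-suc x k 1+ℓx+k≡m) (≤-trans 1+k≤h (≤-trans h≤c c≤ℓ[1+x]))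
      where
      open ≤-Reasoning
      2+x≤h*r : suc (suc x) ≤ h * r
      2+x≤h*r = m<pred[n]⇒suc[m]<n 1+x≤x₀
      c≤ℓ[1+x] : c ≤ ℓ (suc x)
      c≤ℓ[1+x] = c≤ℓ (suc x) (≤-<-trans 2+x≤h*r (m<n+m (h * r) r≥1))
      k : ℕ
      k = m ∸ suc (ℓ x)
      1+ℓx+k≡m : suc (ℓ x) + k ≡ m
      1+ℓx+k≡m = m+[n∸m]≡n (ℓ<m x)
      1+k≤h : suc k ≤ h
      1+k≤h = +-cancelˡ-≤ (ℓ x) (suc k) h (begin
        ℓ x + suc k    ≡⟨ +-suc (ℓ x) k ⟩
        suc (ℓ x) + k  ≡⟨ 1+ℓx+k≡m ⟩
        m              ≡⟨ h+1+c≡m ⟨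
        h + suc c      ≤⟨ +-monoʳ-≤ h (c<ℓ x 2+x≤h*r) ⟩
        h + ℓ x        ≡⟨ +-comm h (ℓ x) ⟩
        ℓ x + h        ∎)

    minExcess-monotone : ∀ x → x₀ ≤ x → minExcess x ℤ.≤ minExcess (suc x)
    minExcess-monotone x x₀≤x =
      +-offset-≤ (sym (minExcess-suc x k 1+ℓx+k≡m)) (≤-trans ℓ[1+x]≤c (≤-trans c≤1+h (s≤s h≤k)))
      where
      open ≤-Reasoning
      h*r≤1+x : h * r ≤ suc x
      h*r≤1+x = pred[n]≤m⇒n≤suc[m] x₀≤x
      ℓ[1+x]≤c : ℓ (suc x) ≤ c
      ℓ[1+x]≤c = ℓ≤c (suc x) (≤-trans h*r≤1+x (n≤1+n (suc x)))
      k : ℕ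
      k = m ∸ suc (ℓ x)
      1+ℓx+k≡m : suc (ℓ x) + k ≡ m
      1+ℓx+k≡m = m+[n∸m]≡n (ℓ<m x)
      h≤k : h ≤ k
      h≤k = +-cancelʳ-≤ (suc c) h k (begin
        h + suc c      ≡⟨ h+1+c≡m ⟩
        m              ≡⟨ 1+ℓx+k≡m ⟨
        suc (ℓ x) + k  ≤⟨ +-monoˡ-≤ k (s≤s (ℓ≤c x h*r≤1+x)) ⟩
        suc c + k      ≡⟨ +-comm (suc c) k ⟩
        k + suc c      ∎)

    excess-*q-minimal : ∀ t → InS m q t → excess m q (h * q) ℤ.≤ excess m q t
    excess-*q-minimal zero     _     = excess-*q≤2 h c h+1+c≡m h≤c
    excess-*q-minimal (suc t′) t∈S = begin
      excess m q (h * q)       ≤⟨ excess-*q≤minExcess h c h+1+c≡m c≤1+h ⟩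
      minExcess x₀             ≤⟨ valley minExcess x₀ minExcess-antitone minExcess-monotone x ⟩
      minExcess x              ≤⟨ minExcess≤excess x j (s≤s z≤n) (m%n<n t′ m) (subst (InS m q) (sym x*m+j≡t) t∈S) ⟩
      excess m q (x * m + j)   ≡⟨ cong (excess m q) x*m+j≡t ⟩
      excess m q (suc t′)      ∎
      where
      open ℤ.≤-Reasoning
      x : ℕ
      x = t′ ℕ./ m
      j : ℕ
      j = suc (t′ % m)
      x*m+j≡t : x * m + j ≡ suc t′
      x*m+j≡t = trans (+-suc (x * m) (t′ % m)) (cong suc (trans (+-comm (x * m) (t′ % m)) (sym (m≡m%n+[m/n]*n t′ m))))

    σ-maximum : ∀ F → IsFrobenius m q F →
                InS m q (h * q) × h * q ≤ F + 1 × ((t : ℕ) → InS m q t → t ≤ F + 1 → σ m q t ℚ.≤ σ m q (h * q))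
    σ-maximum F isF =
      representable⇒InS m q m≥1 q≥1 0 h refl ,
      *q≤F+1 h c F h+1+c≡m h≤c isF ,
      λ t t∈S _ → σ-antitone m q (h * q) t (excess-*q-minimal t t∈S)

    σ-values : (2 ∣ m → σ m q (h * q) ≡ (+ ((m ∸ 2) * (q ∸ 1))) / 8) ×
               (¬ 2 ∣ m → σ m q (h * q) ≡ ((+ m -ℤ + 1) *ℤ (+ q -ℤ + r -ℤ + 1)) / 8)
    σ-values = σ-*q-byParity h c h+1+c≡m c≡h⊎c≡1+h
      where
      c≡h⊎c≡1+h : c ≡ h ⊎ c ≡ suc h
      c≡h⊎c≡1+h with m≤n⇒m<n∨m≡n c≤1+h
      ... | inj₁ c<1+h = inj₁ (≤-antisym (s≤s⁻¹ c<1+h) h≤c)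
      ... | inj₂ c≡1+h = inj₂ c≡1+h

corollary3p7 : (m q r : ℕ) → 2 ≤ m → 1 ≤ q → 1 ≤ r → q + 1 ≡ r * m →
    (F : ℕ) → IsFrobenius m q F →
    let s = q * (⌈ m /2⌉ ∸ 1) in
    (InS m q s × s ≤ F + 1 ×
      ((t : ℕ) → InS m q t → t ≤ F + 1 → σ m q t ≤ℚ σ m q s))
    × (2 ∣ m → σ m q s ≡ (+ ((m ∸ 2) * (q ∸ 1))) / 8)
    × (¬ (2 ∣ m) → σ m q s ≡ ((+ m -ℤ + 1) *ℤ (+ q -ℤ + r -ℤ + 1)) / 8)
corollary3p7 m q r m≥2 q≥1 r≥1 q+1≡r*m F isF =
  subst (λ s → InS m q s × s ≤ F + 1 × ((t : ℕ) → InS m q t → t ≤ F + 1 → σ m q t ≤ℚ σ m q s))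
        h*q≡s (σ-maximum F isF) ,
  subst (λ s → (2 ∣ m → σ m q s ≡ (+ ((m ∸ 2) * (q ∸ 1))) / 8) ×
               (¬ (2 ∣ m) → σ m q s ≡ ((+ m -ℤ + 1) *ℤ (+ q -ℤ + r -ℤ + 1)) / 8))
        h*q≡s σ-values
  where
  h : ℕ
  h = ⌈ m /2⌉ ∸ 1
  h*q≡s : h * q ≡ q * h
  h*q≡s = *-comm h q
  m≥1 : 1 ≤ m
  m≥1 = ≤-trans (s≤s z≤n) m≥2
  open Blocks m q r m≥1 q≥1 r≥1 q+1≡r*m
  open Balanced h ⌊ m /2⌋ (⌈n/2⌉∸1+1+⌊n/2⌋≡n m m≥1) (⌈n/2⌉∸1≤⌊n/2⌋ m) (⌊n/2⌋≤1+[⌈n/2⌉∸1] m)
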